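{- Let $G$ be a finite noncyclic group and $C_0$ a cyclic subgroup of $G$. The following are equivalent: (i) $G$ is a flower group with pistil $C_0$; (ii) for every $g\in G\setminus C_0$ there exists a unique $\mu$-subgroup $C$ of $G$ such that $g\in C$ and $C_0\subseteq C$; (iii) there exist $k\ge1$ and distinct $\mu$-subgroups $C_1,\ldots,C_k$ of $G$ such that $C_i\cap C_j=C_0$ for all $1\le i<j\le k$ and $\sum_{i=1}^k|C_i|-(k-1)|C_0|=|G|$.
   Context: A cyclic subgroup $H$ of a group $G$ is a $\mu$-subgroup if it is not contained in any cyclic subgroup of $G$ other than $H$ itself. A finite noncyclic group $G$, whose set of $\mu$-subgroups is $\{C_1,\ldots,C_k\}$, is a flower group if there is a subgroup $C_0$ of $G$ with $C_i\cap C_j=C_0$ for all $1\le i<j\le k$; $C_0$ is then called the pistil and $C_1,\ldots,C_k$ the petals of $G$. -}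

module Defs where

open import Data.Nat using (ℕ; zero; suc; _+_; _*_; _∸_)
open import Data.Integer using (ℤ; +_; -[1+_])
open import Data.Fin using (Fin; _<_)
open import Data.Fin.Subset using (Subset; _∈_; _∉_; _⊆_; _∩_; ∣_∣)
open import Data.List using (map; allFin)
open import Data.Nat.ListAction using (sum)
open import Data.Product using (Σ; ∃; ∃-syntax; _×_; ∃!)
open import Relation.Binary.PropositionalEquality using (_≡_; _≢_)
open import Relation.Nullary using (¬_)
open import Algebra.Structures using (IsGroup)

-- A finite group, with carrier Fin order (every finite group is isomorphic
-- to one of this shape); equality is propositional equality on Fin order.
record FinGroup : Set where
  field
    order   : ℕ
    _∙_     : Fin order → Fin order → Fin order
    ε       : Fin order
    _⁻¹     : Fin order → Fin order
    isGroup : IsGroup _≡_ _∙_ ε _⁻¹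

module _ (G : FinGroup) where
  open FinGroup G

  Elt : Set
  Elt = Fin order

  SubsetG : Set
  SubsetG = Subset order

  _^ₙ_ : Elt → ℕ → Elt
  g ^ₙ zero  = ε
  g ^ₙ suc k = g ∙ (g ^ₙ k)

  _^_ : Elt → ℤ → Elt
  g ^ (+ k)     = g ^ₙ k
  g ^ -[1+ k ]  = (g ^ₙ suc k) ⁻¹

  IsSubgroup : SubsetG → Set
  IsSubgroup H = (ε ∈ H)
               × (∀ x y → x ∈ H → y ∈ H → (x ∙ y) ∈ H)
               × (∀ x → x ∈ H → (x ⁻¹) ∈ H)

  IsCyclicSubgroup : SubsetG → Set
  IsCyclicSubgroup H = IsSubgroup H
                     × (∃[ g ] (g ∈ H × (∀ x → x ∈ H → ∃[ k ] (x ≡ g ^ k))))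

  IsCyclicGroup : Set
  IsCyclicGroup = ∃[ g ] (∀ x → ∃[ k ] (x ≡ g ^ k))

  IsMuSubgroup : SubsetG → Set
  IsMuSubgroup H = IsCyclicSubgroup H
                 × (∀ K → IsCyclicSubgroup K → H ⊆ K → K ≡ H)

  IsFlowerWithPistil : SubsetG → Set
  IsFlowerWithPistil C₀ = (¬ IsCyclicGroup)
                        × IsSubgroup C₀
                        × (∀ C D → IsMuSubgroup C → IsMuSubgroup D → C ≢ D → (C ∩ D) ≡ C₀)

  ConditionII : SubsetG → Set
  ConditionII C₀ = ∀ g → g ∉ C₀ →
    ∃! _≡_ (λ C → IsMuSubgroup C × g ∈ C × C₀ ⊆ C)

  -- condition (iii); the equation Σ|Cᵢ| - (k-1)|C₀| = |G| is written
  -- additively as Σ|Cᵢ| = |G| + (k-1)|C₀|.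
  ConditionIII : SubsetG → Set
  ConditionIII C₀ = ∃[ k ] Σ (Fin (suc k) → SubsetG) λ Cs →
      (∀ i → IsMuSubgroup (Cs i))
    × (∀ i j → i ≢ j → Cs i ≢ Cs j)
    × (∀ i j → i < j → (Cs i ∩ Cs j) ≡ C₀)
    × (sum (map (λ i → ∣ Cs i ∣) (allFin (suc k))) ≡ order + k * ∣ C₀ ∣)

-- Every g ∈ G lies in a μ-subgroup (a maximal cyclic subgroup above ⟨g⟩), and a μ-subgroup C
-- is the only cyclic subgroup containing a generator of C.  (i) ⇒ (ii): two μ-subgroups through
-- g ∉ C₀ would meet in more than C₀, and C₀ lies in every petal because G is not cyclic, so
-- there is a second petal.  (ii) ⇒ (i): applying (ii) to a generator shows C₀ ⊆ C for every
-- μ-subgroup C, and a common element of two petals outside C₀ contradicts uniqueness.  For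
-- (iii), inclusion–exclusion gives Σ|Cᵢ| = |⋃Cᵢ| + k|C₀| when the Cᵢ (i ≤ k) pairwise meet
-- in C₀, so the equation of (iii) says precisely that the Cᵢ cover G; covering G, they contain
-- the generator of every μ-subgroup and are therefore all of them.

module Submission where

open import Defs
open import Algebra.Bundles using (Group)
open import Algebra.Structures using (IsGroup)
import Algebra.Properties.Group as GroupProperties
import Data.Bool as Bool
open import Data.Empty using (⊥-elim)
open import Data.Fin as Fin using (Fin; toℕ; fromℕ<)
import Data.Fin.Properties as Finₚ
open import Data.Fin.Subset
  using (Subset; _∈_; _∉_; _⊆_; _⊃_; _∩_; _∪_; ∣_∣; inside; outside; ⊤)
open import Data.Fin.Subset.Induction using (⊃-wellFounded)
open import Data.Fin.Subset.Properties
  using ( _∈?_; _⊆?_; _⊂?_; anySubset?; ⊆-antisym; ⊆-reflexive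
        ; x∈p∩q⁺; x∈p∩q⁻; p∩q⊆p; x∈p∪q⁺; x∈p∪q⁻; ∩-comm; ∩-distribˡ-∪; ∪-idem
        ; ∈⊤; ∣⊤∣≡n; ∣p∣≡n⇒p≡⊤ )
open import Data.List as List using (List; []; _∷_; allFin; tabulate; filter; deduplicate)
import Data.List.Properties as Listₚ
open import Data.List.Membership.Propositional using () renaming (_∈_ to _∈ₗ_)
import Data.List.Membership.Propositional.Properties as ∈ₗ
open import Data.List.Relation.Unary.AllPairs using (_∷_)
import Data.List.Relation.Unary.All as All
import Data.List.Relation.Unary.Any as Any
import Data.List.Relation.Unary.Any.Properties as Anyₚ
open import Data.List.Relation.Unary.Unique.Propositional using (Unique)
import Data.List.Relation.Unary.Unique.DecPropositional.Properties as DecUniqueₚ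
open import Data.Nat as ℕ using (ℕ; zero; suc; _+_; _*_)
import Data.Nat.Properties as ℕₚ
open import Data.Nat.DivMod using (_%_; _/_; m≡m%n+[m/n]*n; m%n<n)
open import Data.Nat.ListAction using (sum)
open import Data.Integer as ℤ using (ℤ; -[1+_])
open import Data.Product using (∃-syntax; _×_; _,_; proj₁; proj₂)
open import Data.Sum using (inj₁; inj₂)
open import Data.Vec using ([]; _∷_)
import Data.Vec as Vec
import Data.Vec.Properties as Vecₚ
open import Function using (_∘_; id)
open import Function.Bundles using (_⇔_; mk⇔; Equivalence)
import Function.Properties.Equivalence as ⇔
open import Induction.WellFounded using (Acc; acc)
open import Level using (Level; 0ℓ)
open import Relation.Binary.Definitions using (DecidableEquality; tri<; tri≈; tri>)
open import Relation.Binary.PropositionalEquality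
open import Relation.Nullary
open import Relation.Nullary.Decidable as Dec using (map′; decidable-stable; dec-true; _×-dec_; _→-dec_; ¬?)
open import Relation.Unary using (Pred; Decidable)

private
  variable
    ℓ : Level
    n k : ℕ

_≟ₛ_ : DecidableEquality (Subset n)
_≟ₛ_ = Vecₚ.≡-dec Bool._≟_

module _ {P : Pred (Fin n) ℓ} (P? : Decidable P) where

  toSubset : Subset n
  toSubset = Vec.tabulate (does ∘ P?)

  ∈-toSubset⁺ : ∀ {x} → P x → x ∈ toSubset
  ∈-toSubset⁺ {x} px =
    Vecₚ.lookup⇒[]= x _ (trans (Vecₚ.lookup∘tabulate (does ∘ P?) x) (dec-true (P? x) px))

  ∈-toSubset⁻ : ∀ {x} → x ∈ toSubset → P x
  ∈-toSubset⁻ {x} x∈ with P? x | trans (sym (Vecₚ.lookup∘tabulate (does ∘ P?) x)) (Vecₚ.[]=⇒lookup x∈)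
  ... | yes px | _  = px
  ... | no  _  | ()

allSubset? : {P : Pred (Subset n) ℓ} → Decidable P → Dec (∀ p → P p)
allSubset? P? with anySubset? (¬? ∘ P?)
... | yes (p , ¬Pp) = no (λ ∀P → ¬Pp (∀P p))
... | no  ∄¬P       = yes (λ p → decidable-stable (P? p) (λ ¬Pp → ∄¬P (p , ¬Pp)))

Maximal : Pred (Subset n) ℓ → Pred (Subset n) ℓ
Maximal P C = P C × (∀ K → P K → C ⊆ K → K ≡ C)

maximal? : {P : Pred (Subset n) ℓ} → Decidable P → Decidable (Maximal P)
maximal? P? C = P? C ×-dec allSubset? (λ K → P? K →-dec (C ⊆? K →-dec K ≟ₛ C))

maximal-above : {P : Pred (Subset n) ℓ} → Decidable P →
                ∀ {H} → P H → ∃[ C ] (Maximal P C × H ⊆ C)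
maximal-above {P = P} P? = go (⊃-wellFounded _)
  where
  go : ∀ {H} → Acc _⊃_ H → P H → ∃[ C ] (Maximal P C × H ⊆ C)
  go {H} (acc rs) pH with anySubset? (λ K → P? K ×-dec H ⊂? K)
  ... | yes (K , pK , H⊂K) =
    let C , maxC , K⊆C = go (rs H⊂K) pK in C , maxC , K⊆C ∘ proj₁ H⊂K
  ... | no ∄K = H , (pH , H-maximal) , id
    where
    H-maximal : ∀ K → P K → H ⊆ K → K ≡ H
    H-maximal K pK H⊆K = ⊆-antisym
      (λ {x} x∈K → decidable-stable (x ∈? H) (λ x∉H → ∄K (K , pK , H⊆K , x , x∈K , x∉H)))
      H⊆K

∣p∪q∣+∣p∩q∣≡∣p∣+∣q∣ : (p q : Subset n) → ∣ p ∪ q ∣ + ∣ p ∩ q ∣ ≡ ∣ p ∣ + ∣ q ∣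
∣p∪q∣+∣p∩q∣≡∣p∣+∣q∣ []            []            = refl
∣p∪q∣+∣p∩q∣≡∣p∣+∣q∣ (inside  ∷ p) (inside  ∷ q) = cong suc (begin
  ∣ p ∪ q ∣ + suc ∣ p ∩ q ∣  ≡⟨ ℕₚ.+-suc ∣ p ∪ q ∣ ∣ p ∩ q ∣ ⟩
  suc (∣ p ∪ q ∣ + ∣ p ∩ q ∣) ≡⟨ cong suc (∣p∪q∣+∣p∩q∣≡∣p∣+∣q∣ p q) ⟩
  suc (∣ p ∣ + ∣ q ∣)         ≡⟨ ℕₚ.+-suc ∣ p ∣ ∣ q ∣ ⟨
  ∣ p ∣ + suc ∣ q ∣           ∎)
  where open ≡-Reasoning
∣p∪q∣+∣p∩q∣≡∣p∣+∣q∣ (inside  ∷ p) (outside ∷ q) = cong suc (∣p∪q∣+∣p∩q∣≡∣p∣+∣q∣ p q)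
∣p∪q∣+∣p∩q∣≡∣p∣+∣q∣ (outside ∷ p) (inside  ∷ q) =
  trans (cong suc (∣p∪q∣+∣p∩q∣≡∣p∣+∣q∣ p q)) (sym (ℕₚ.+-suc ∣ p ∣ ∣ q ∣))
∣p∪q∣+∣p∩q∣≡∣p∣+∣q∣ (outside ∷ p) (outside ∷ q) = ∣p∪q∣+∣p∩q∣≡∣p∣+∣q∣ p q

⋃ᶠ : (Fin (suc k) → Subset n) → Subset n
⋃ᶠ {k = zero}  Cs = Cs Fin.zero
⋃ᶠ {k = suc k} Cs = Cs Fin.zero ∪ ⋃ᶠ (Cs ∘ Fin.suc)

x∈⋃ᶠ⁺ : (Cs : Fin (suc k) → Subset n) (i : Fin (suc k)) → ∀ {x} → x ∈ Cs i → x ∈ ⋃ᶠ Cs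
x∈⋃ᶠ⁺ {k = zero}  Cs Fin.zero    x∈ = x∈
x∈⋃ᶠ⁺ {k = suc k} Cs Fin.zero    x∈ = x∈p∪q⁺ (inj₁ x∈)
x∈⋃ᶠ⁺ {k = suc k} Cs (Fin.suc i) x∈ = x∈p∪q⁺ (inj₂ (x∈⋃ᶠ⁺ (Cs ∘ Fin.suc) i x∈))

x∈⋃ᶠ⁻ : (Cs : Fin (suc k) → Subset n) → ∀ {x} → x ∈ ⋃ᶠ Cs → ∃[ i ] x ∈ Cs i
x∈⋃ᶠ⁻ {k = zero}  Cs x∈ = Fin.zero , x∈
x∈⋃ᶠ⁻ {k = suc k} Cs x∈ with x∈p∪q⁻ (Cs Fin.zero) (⋃ᶠ (Cs ∘ Fin.suc)) x∈
... | inj₁ x∈C₀ = Fin.zero , x∈C₀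
... | inj₂ x∈⋃ = let i , x∈Cᵢ = x∈⋃ᶠ⁻ (Cs ∘ Fin.suc) x∈⋃ in Fin.suc i , x∈Cᵢ

p∩⋃ᶠ : ∀ (p : Subset n) (Cs : Fin (suc k) → Subset n) {r} → (∀ j → p ∩ Cs j ≡ r) → p ∩ ⋃ᶠ Cs ≡ r
p∩⋃ᶠ {k = zero}  p Cs p∩C≡r = p∩C≡r Fin.zero
p∩⋃ᶠ {k = suc k} p Cs {r} p∩C≡r = begin
  p ∩ (Cs Fin.zero ∪ ⋃ᶠ (Cs ∘ Fin.suc))           ≡⟨ ∩-distribˡ-∪ p _ _ ⟩
  (p ∩ Cs Fin.zero) ∪ (p ∩ ⋃ᶠ (Cs ∘ Fin.suc))     ≡⟨ cong₂ _∪_ (p∩C≡r Fin.zero)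
                                                               (p∩⋃ᶠ p (Cs ∘ Fin.suc) (p∩C≡r ∘ Fin.suc)) ⟩
  r ∪ r                                           ≡⟨ ∪-idem r ⟩
  r                                               ∎
  where open ≡-Reasoning

sum∣Cs∣≡∣⋃ᶠCs∣+k*∣C₀∣ : (Cs : Fin (suc k) → Subset n) {C₀ : Subset n} →
  (∀ i j → i Fin.< j → Cs i ∩ Cs j ≡ C₀) →
  sum (List.map (λ i → ∣ Cs i ∣) (allFin (suc k))) ≡ ∣ ⋃ᶠ Cs ∣ + k * ∣ C₀ ∣
sum∣Cs∣≡∣⋃ᶠCs∣+k*∣C₀∣ Cs petals =
  trans (cong sum (Listₚ.map-tabulate id (λ i → ∣ Cs i ∣))) (count Cs petals)
  where
  count : ∀ {k} (Cs : Fin (suc k) → Subset n) {C₀} → (∀ i j → i Fin.< j → Cs i ∩ Cs j ≡ C₀) →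
          sum (tabulate (λ i → ∣ Cs i ∣)) ≡ ∣ ⋃ᶠ Cs ∣ + k * ∣ C₀ ∣
  count {k = zero}  Cs petals = refl
  count {k = suc k} Cs {C₀} petals = begin
    a + sum (tabulate (λ i → ∣ Cs (Fin.suc i) ∣)) ≡⟨ cong (a +_) (count (Cs ∘ Fin.suc) later-petals) ⟩
    a + (∣ U ∣ + k * c)                           ≡⟨ ℕₚ.+-assoc a ∣ U ∣ (k * c) ⟨
    (a + ∣ U ∣) + k * c                           ≡⟨ cong (_+ k * c) (∣p∪q∣+∣p∩q∣≡∣p∣+∣q∣ C U) ⟨
    (∣ C ∪ U ∣ + ∣ C ∩ U ∣) + k * c               ≡⟨ cong (λ D → (∣ C ∪ U ∣ + ∣ D ∣) + k * c) C∩U≡C₀ ⟩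
    (∣ C ∪ U ∣ + c) + k * c                       ≡⟨ ℕₚ.+-assoc ∣ C ∪ U ∣ c (k * c) ⟩
    ∣ C ∪ U ∣ + (c + k * c)                       ∎
    where
    open ≡-Reasoning
    C = Cs Fin.zero
    U = ⋃ᶠ (Cs ∘ Fin.suc)
    a = ∣ C ∣
    c = ∣ C₀ ∣
    later-petals : ∀ i j → i Fin.< j → Cs (Fin.suc i) ∩ Cs (Fin.suc j) ≡ C₀
    later-petals i j = petals (Fin.suc i) (Fin.suc j) ∘ ℕ.s≤s
    C∩U≡C₀ : C ∩ U ≡ C₀
    C∩U≡C₀ = p∩⋃ᶠ C (Cs ∘ Fin.suc) (λ j → petals Fin.zero (Fin.suc j) (ℕ.s≤s ℕ.z≤n))

sum∣Cs∣≡n+k*∣C₀∣⇔⋃ᶠCs≡⊤ : (Cs : Fin (suc k) → Subset n) {C₀ : Subset n} →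
  (∀ i j → i Fin.< j → Cs i ∩ Cs j ≡ C₀) →
  (sum (List.map (λ i → ∣ Cs i ∣) (allFin (suc k))) ≡ n + k * ∣ C₀ ∣) ⇔ (⋃ᶠ Cs ≡ ⊤)
sum∣Cs∣≡n+k*∣C₀∣⇔⋃ᶠCs≡⊤ {k = k} {n = n} Cs {C₀} petals = mk⇔
  (λ sum≡ → ∣p∣≡n⇒p≡⊤ (ℕₚ.+-cancelʳ-≡ (k * ∣ C₀ ∣) ∣ ⋃ᶠ Cs ∣ n
                        (trans (sym (sum∣Cs∣≡∣⋃ᶠCs∣+k*∣C₀∣ Cs petals)) sum≡)))
  (λ ⋃Cs≡⊤ → trans (sum∣Cs∣≡∣⋃ᶠCs∣+k*∣C₀∣ Cs petals)
                    (cong (_+ k * ∣ C₀ ∣) (trans (cong ∣_∣ ⋃Cs≡⊤) (∣⊤∣≡n n))))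

lookup-injective : {A : Set ℓ} {xs : List A} → Unique xs →
                   ∀ i j → List.lookup xs i ≡ List.lookup xs j → i ≡ j
lookup-injective (_     ∷ _) Fin.zero    Fin.zero    _  = refl
lookup-injective (x∉xs ∷ _) Fin.zero    (Fin.suc j) eq = ⊥-elim (All.lookup x∉xs (∈ₗ.∈-lookup j) eq)
lookup-injective (x∉xs ∷ _) (Fin.suc i) Fin.zero    eq = ⊥-elim (All.lookup x∉xs (∈ₗ.∈-lookup i) (sym eq))
lookup-injective (_     ∷ u) (Fin.suc i) (Fin.suc j) eq = cong Fin.suc (lookup-injective u i j eq)

module _ (G : FinGroup) where
  open FinGroup G
  open IsGroup isGroup using (assoc; identityˡ; identityʳ)

  private
    group : Group 0ℓ 0ℓ
    group = record { isGroup = isGroup }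

  open GroupProperties group using (∙-cancelˡ; inverseʳ-unique)

  infixr 30 _^ℕ_ _^ℤ_

  _^ℕ_ : Elt G → ℕ → Elt G
  _^ℕ_ = _^ₙ_ G

  _^ℤ_ : Elt G → ℤ → Elt G
  _^ℤ_ = _^_ G

  ^ℕ-+ : ∀ g m n → g ^ℕ (m + n) ≡ g ^ℕ m ∙ g ^ℕ n
  ^ℕ-+ g zero    n = sym (identityˡ _)
  ^ℕ-+ g (suc m) n = trans (cong (g ∙_) (^ℕ-+ g m n)) (sym (assoc g _ _))

  -- Pigeonhole on g⁰, …, g^order gives gⁱ = gʲ with i < j, and cancelling gⁱ leaves g^(j-i) = ε.
  finite-order : ∀ g → ∃[ e ] g ^ℕ suc e ≡ ε
  finite-order g with Finₚ.pigeonhole (ℕₚ.n<1+n order) (λ (i : Fin (suc order)) → g ^ℕ toℕ i)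
  ... | i , j , i<j , gⁱ≡gʲ with ℕₚ.m≤n⇒∃[o]m+o≡n i<j
  ... | e , 1+i+e≡j = e , sym (∙-cancelˡ (g ^ℕ toℕ i) ε (g ^ℕ suc e) (begin
    g ^ℕ toℕ i ∙ ε             ≡⟨ identityʳ _ ⟩
    g ^ℕ toℕ i                 ≡⟨ gⁱ≡gʲ ⟩
    g ^ℕ toℕ j                 ≡⟨ cong (g ^ℕ_) (trans (sym 1+i+e≡j) (sym (ℕₚ.+-suc (toℕ i) e))) ⟩
    g ^ℕ (toℕ i + suc e)       ≡⟨ ^ℕ-+ g (toℕ i) (suc e) ⟩
    g ^ℕ toℕ i ∙ g ^ℕ suc e    ∎))
    where open ≡-Reasoning

  module _ (g : Elt G) (e : ℕ) (gᵖ≡ε : g ^ℕ suc e ≡ ε) where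

    ^ℕ-multiple-of-period : ∀ q → g ^ℕ (q * suc e) ≡ ε
    ^ℕ-multiple-of-period zero    = refl
    ^ℕ-multiple-of-period (suc q) = begin
      g ^ℕ (suc e + q * suc e)        ≡⟨ ^ℕ-+ g (suc e) (q * suc e) ⟩
      g ^ℕ suc e ∙ g ^ℕ (q * suc e)   ≡⟨ cong₂ _∙_ gᵖ≡ε (^ℕ-multiple-of-period q) ⟩
      ε ∙ ε                           ≡⟨ identityˡ ε ⟩
      ε                               ∎
      where open ≡-Reasoning

    ^ℕ-mod-period : ∀ m → g ^ℕ m ≡ g ^ℕ (m % suc e)
    ^ℕ-mod-period m = begin
      g ^ℕ m                                        ≡⟨ cong (g ^ℕ_) (m≡m%n+[m/n]*n m (suc e)) ⟩
      g ^ℕ (m % suc e + (m / suc e) * suc e)        ≡⟨ ^ℕ-+ g (m % suc e) _ ⟩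
      g ^ℕ (m % suc e) ∙ g ^ℕ ((m / suc e) * suc e) ≡⟨ cong (g ^ℕ (m % suc e) ∙_)
                                                           (^ℕ-multiple-of-period (m / suc e)) ⟩
      g ^ℕ (m % suc e) ∙ ε                          ≡⟨ identityʳ _ ⟩
      g ^ℕ (m % suc e)                              ∎
      where open ≡-Reasoning

    ^ℕ-⁻¹ : ∀ m → (g ^ℕ m) ⁻¹ ≡ g ^ℕ (e * m)
    ^ℕ-⁻¹ m = sym (inverseʳ-unique (g ^ℕ m) _ (begin
      g ^ℕ m ∙ g ^ℕ (e * m)  ≡⟨ ^ℕ-+ g m (e * m) ⟨
      g ^ℕ (suc e * m)       ≡⟨ cong (g ^ℕ_) (ℕₚ.*-comm (suc e) m) ⟩
      g ^ℕ (m * suc e)       ≡⟨ ^ℕ-multiple-of-period m ⟩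
      ε                      ∎))
      where open ≡-Reasoning

  ^ℤ-natural : ∀ g k → ∃[ m ] g ^ℤ k ≡ g ^ℕ m
  ^ℤ-natural g (ℤ.+ m)  = m , refl
  ^ℤ-natural g -[1+ m ] =
    let e , gᵖ≡ε = finite-order g in e * suc m , ^ℕ-⁻¹ g e gᵖ≡ε (suc m)

  IsPowerOf : Elt G → Pred (Elt G) 0ℓ
  IsPowerOf g x = ∃[ m ] x ≡ g ^ℕ m

  -- It suffices to search the exponents below the period.
  isPowerOf? : ∀ g → Decidable (IsPowerOf g)
  isPowerOf? g x = map′
    (λ (i , x≡gⁱ) → toℕ i , x≡gⁱ)
    (λ (m , x≡gᵐ) → fromℕ< (m%n<n m (suc e)) ,
      trans x≡gᵐ (trans (^ℕ-mod-period g e gᵖ≡ε m)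
                        (cong (g ^ℕ_) (sym (Finₚ.toℕ-fromℕ< (m%n<n m (suc e)))))))
    (Finₚ.any? (λ (i : Fin (suc e)) → x Finₚ.≟ g ^ℕ toℕ i))
    where
    e = proj₁ (finite-order g)
    gᵖ≡ε = proj₂ (finite-order g)

  ⟨_⟩ : Elt G → SubsetG G
  ⟨ g ⟩ = toSubset (isPowerOf? g)

  ^ℕ∈⟨⟩ : ∀ g m → g ^ℕ m ∈ ⟨ g ⟩
  ^ℕ∈⟨⟩ g m = ∈-toSubset⁺ (isPowerOf? g) (m , refl)

  g∈⟨g⟩ : ∀ g → g ∈ ⟨ g ⟩
  g∈⟨g⟩ g = subst (_∈ ⟨ g ⟩) (identityʳ g) (^ℕ∈⟨⟩ g 1)

  ⟨⟩-isSubgroup : ∀ g → IsSubgroup G ⟨ g ⟩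
  ⟨⟩-isSubgroup g = ^ℕ∈⟨⟩ g 0 , ∙-closed , ⁻¹-closed
    where
    ∙-closed : ∀ x y → x ∈ ⟨ g ⟩ → y ∈ ⟨ g ⟩ → x ∙ y ∈ ⟨ g ⟩
    ∙-closed x y x∈ y∈ with ∈-toSubset⁻ (isPowerOf? g) x∈ | ∈-toSubset⁻ (isPowerOf? g) y∈
    ... | a , refl | b , refl = subst (_∈ ⟨ g ⟩) (^ℕ-+ g a b) (^ℕ∈⟨⟩ g (a + b))
    ⁻¹-closed : ∀ x → x ∈ ⟨ g ⟩ → x ⁻¹ ∈ ⟨ g ⟩
    ⁻¹-closed x x∈ with ∈-toSubset⁻ (isPowerOf? g) x∈ | finite-order g
    ... | a , refl | e , gᵖ≡ε = subst (_∈ ⟨ g ⟩) (sym (^ℕ-⁻¹ g e gᵖ≡ε a)) (^ℕ∈⟨⟩ g (e * a))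

  ⟨⟩-isCyclicSubgroup : ∀ g → IsCyclicSubgroup G ⟨ g ⟩
  ⟨⟩-isCyclicSubgroup g = ⟨⟩-isSubgroup g , g , g∈⟨g⟩ g ,
    λ x x∈ → let m , x≡gᵐ = ∈-toSubset⁻ (isPowerOf? g) x∈ in ℤ.+ m , x≡gᵐ

  ⟨⟩-least : ∀ {H g} → IsSubgroup G H → g ∈ H → ⟨ g ⟩ ⊆ H
  ⟨⟩-least {H} {g} (ε∈H , ∙-closed , _) g∈H x∈ with ∈-toSubset⁻ (isPowerOf? g) x∈
  ... | m , x≡gᵐ = subst (_∈ H) (sym x≡gᵐ) (^ℕ∈H m)
    where
    ^ℕ∈H : ∀ m → g ^ℕ m ∈ H
    ^ℕ∈H zero    = ε∈H
    ^ℕ∈H (suc m) = ∙-closed g _ g∈H (^ℕ∈H m)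

  isCyclicSubgroup⇔≡⟨⟩ : ∀ {H} → IsCyclicSubgroup G H ⇔ (∃[ g ] H ≡ ⟨ g ⟩)
  isCyclicSubgroup⇔≡⟨⟩ {H} = mk⇔
    (λ (H-sub , g , g∈H , H-powers) → g , ⊆-antisym
      (λ {x} x∈H → let k , x≡gᵏ = H-powers x x∈H ; m , gᵏ≡gᵐ = ^ℤ-natural g k in
                   ∈-toSubset⁺ (isPowerOf? g) (m , trans x≡gᵏ gᵏ≡gᵐ))
      (⟨⟩-least H-sub g∈H))
    (λ (g , H≡⟨g⟩) → subst (IsCyclicSubgroup G) (sym H≡⟨g⟩) (⟨⟩-isCyclicSubgroup g))

  isCyclicSubgroup? : Decidable (IsCyclicSubgroup G)
  isCyclicSubgroup? H =
    Dec.map (⇔.sym isCyclicSubgroup⇔≡⟨⟩) (Finₚ.any? (λ g → H ≟ₛ ⟨ g ⟩))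

  isMuSubgroup? : Decidable (IsMuSubgroup G)
  isMuSubgroup? = maximal? isCyclicSubgroup?

  ∈-μ-subgroup : ∀ g → ∃[ C ] (IsMuSubgroup G C × g ∈ C)
  ∈-μ-subgroup g =
    let C , μC , ⟨g⟩⊆C = maximal-above isCyclicSubgroup? (⟨⟩-isCyclicSubgroup g)
    in C , μC , ⟨g⟩⊆C (g∈⟨g⟩ g)

  μ-generator : ∀ {C} → IsMuSubgroup G C → ∃[ c ] (∀ K → IsCyclicSubgroup G K → c ∈ K → K ≡ C)
  μ-generator (cyclicC , maximalC) with Equivalence.to isCyclicSubgroup⇔≡⟨⟩ cyclicC
  ... | c , refl = c , λ K cyclicK c∈K → maximalC K cyclicK (⟨⟩-least (proj₁ cyclicK) c∈K)

  -- Every μ-subgroup is some ⟨ g ⟩, so running g over G lists them all.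
  μ-subgroup-candidates : List (SubsetG G)
  μ-subgroup-candidates = filter isMuSubgroup? (List.map ⟨_⟩ (allFin order))

  μ-subgroups : List (SubsetG G)
  μ-subgroups = deduplicate _≟ₛ_ μ-subgroup-candidates

  μ-subgroups-unique : Unique μ-subgroups
  μ-subgroups-unique = DecUniqueₚ.deduplicate-! _≟ₛ_ μ-subgroup-candidates

  ∈-μ-subgroups⁺ : ∀ {C} → IsMuSubgroup G C → C ∈ₗ μ-subgroups
  ∈-μ-subgroups⁺ {C} μC =
    let c , C≡⟨c⟩ = Equivalence.to isCyclicSubgroup⇔≡⟨⟩ (proj₁ μC)
        C∈⟨G⟩ = subst (_∈ₗ List.map ⟨_⟩ (allFin order)) (sym C≡⟨c⟩)
                      (∈ₗ.∈-map⁺ ⟨_⟩ (∈ₗ.∈-allFin c))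
    in ∈ₗ.∈-deduplicate⁺ _≟ₛ_ (∈ₗ.∈-filter⁺ isMuSubgroup? C∈⟨G⟩ μC)

  ∈-μ-subgroups⁻ : ∀ {C} → C ∈ₗ μ-subgroups → IsMuSubgroup G C
  ∈-μ-subgroups⁻ C∈ =
    proj₂ (∈ₗ.∈-filter⁻ isMuSubgroup? {xs = List.map ⟨_⟩ (allFin order)}
                        (∈ₗ.∈-deduplicate⁻ _≟ₛ_ μ-subgroup-candidates C∈))

  module _ (¬cyclic : ¬ IsCyclicGroup G) where

    cyclic-subgroup-proper : ∀ {C} → IsCyclicSubgroup G C → ∃[ x ] x ∉ C
    cyclic-subgroup-proper {C} (_ , c , _ , C-powers) with Finₚ.any? (λ x → ¬? (x ∈? C))
    ... | yes x∉C = x∉C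
    ... | no  ∄x  = ⊥-elim (¬cyclic (c , λ x →
      C-powers x (decidable-stable (x ∈? C) (λ x∉C → ∄x (x , x∉C)))))

    another-μ-subgroup : ∀ {C} → IsMuSubgroup G C → ∃[ D ] (IsMuSubgroup G D × D ≢ C)
    another-μ-subgroup (cyclicC , _) =
      let x , x∉C = cyclic-subgroup-proper cyclicC
          D , μD , x∈D = ∈-μ-subgroup x
      in D , μD , λ D≡C → x∉C (subst (x ∈_) D≡C x∈D)

  module _ {C₀ : SubsetG G} where

    pistil⊆μ-subgroup : IsFlowerWithPistil G C₀ → ∀ {C} → IsMuSubgroup G C → C₀ ⊆ C
    pistil⊆μ-subgroup (¬cyclic , _ , petals) {C} μC {x} x∈C₀ =
      let D , μD , D≢C = another-μ-subgroup ¬cyclic μC in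
      p∩q⊆p C D (subst (x ∈_) (sym (petals C D μC μD (D≢C ∘ sym))) x∈C₀)

    flower⇒II : IsFlowerWithPistil G C₀ → ConditionII G C₀
    flower⇒II flower@(_ , _ , petals) g g∉C₀ =
      let C , μC , g∈C = ∈-μ-subgroup g in
      C , (μC , g∈C , pistil⊆μ-subgroup flower μC) ,
      λ {D} (μD , g∈D , _) → decidable-stable (C ≟ₛ D)
        (λ C≢D → g∉C₀ (subst (g ∈_) (petals C D μC μD C≢D) (x∈p∩q⁺ (g∈C , g∈D))))

    II⇒flower : ¬ IsCyclicGroup G → IsCyclicSubgroup G C₀ → ConditionII G C₀ →
                IsFlowerWithPistil G C₀
    II⇒flower ¬cyclic cyclicC₀ II = ¬cyclic , proj₁ cyclicC₀ , λ C D μC μD C≢D →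
      ⊆-antisym (C∩D⊆C₀ μC μD C≢D) (λ x∈C₀ → x∈p∩q⁺ (C₀⊆ μC x∈C₀ , C₀⊆ μD x∈C₀))
      where
      -- If a generator c of C lies in C₀ then the cyclic C₀ equals C; otherwise (ii) puts C₀
      -- into a μ-subgroup through c, which is again C.
      C₀⊆ : ∀ {C} → IsMuSubgroup G C → C₀ ⊆ C
      C₀⊆ μC with μ-generator μC
      ... | c , absorbs with c ∈? C₀
      ... | yes c∈C₀ = ⊆-reflexive (absorbs C₀ cyclicC₀ c∈C₀)
      ... | no  c∉C₀ =
        let D , (μD , c∈D , C₀⊆D) , _ = II c c∉C₀ in subst (C₀ ⊆_) (absorbs D (proj₁ μD) c∈D) C₀⊆D

      C∩D⊆C₀ : ∀ {C D} → IsMuSubgroup G C → IsMuSubgroup G D → C ≢ D → C ∩ D ⊆ C₀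
      C∩D⊆C₀ {C} {D} μC μD C≢D {x} x∈C∩D = decidable-stable (x ∈? C₀) λ x∉C₀ →
        let _ , _ , unique = II x x∉C₀
            x∈C , x∈D = x∈p∩q⁻ C D x∈C∩D
        in C≢D (trans (sym (unique (μC , x∈C , C₀⊆ μC))) (unique (μD , x∈D , C₀⊆ μD)))

    III⇒flower : ¬ IsCyclicGroup G → IsSubgroup G C₀ → ConditionIII G C₀ →
                 IsFlowerWithPistil G C₀
    III⇒flower ¬cyclic subgroupC₀ (k , Cs , μCs , _ , petals , sum≡) = ¬cyclic , subgroupC₀ , pairwise
      where
      ⋃Cs≡⊤ : ⋃ᶠ Cs ≡ ⊤
      ⋃Cs≡⊤ = Equivalence.to (sum∣Cs∣≡n+k*∣C₀∣⇔⋃ᶠCs≡⊤ Cs petals) sum≡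

      index : ∀ {C} → IsMuSubgroup G C → ∃[ i ] Cs i ≡ C
      index μC =
        let c , absorbs = μ-generator μC
            i , c∈Cᵢ = x∈⋃ᶠ⁻ Cs (subst (c ∈_) (sym ⋃Cs≡⊤) ∈⊤)
        in i , absorbs (Cs i) (proj₁ (μCs i)) c∈Cᵢ

      petals-distinct : ∀ {i j} → i ≢ j → Cs i ∩ Cs j ≡ C₀
      petals-distinct {i} {j} i≢j with Finₚ.<-cmp i j
      ... | tri< i<j _ _ = petals i j i<j
      ... | tri≈ _ i≡j _ = ⊥-elim (i≢j i≡j)
      ... | tri> _ _ j<i = trans (∩-comm (Cs i) (Cs j)) (petals j i j<i)

      pairwise : ∀ C D → IsMuSubgroup G C → IsMuSubgroup G D → C ≢ D → C ∩ D ≡ C₀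
      pairwise C D μC μD C≢D =
        let i , Cᵢ≡C = index μC
            j , Cⱼ≡D = index μD
        in subst₂ (λ C D → C ∩ D ≡ C₀) Cᵢ≡C Cⱼ≡D
                  (petals-distinct (λ i≡j → C≢D (trans (sym Cᵢ≡C) (trans (cong Cs i≡j) Cⱼ≡D))))

    enumeration⇒III : (Cs : List (SubsetG G)) → Unique Cs →
      (∀ {C} → IsMuSubgroup G C → C ∈ₗ Cs) → (∀ {C} → C ∈ₗ Cs → IsMuSubgroup G C) →
      (∀ C D → IsMuSubgroup G C → IsMuSubgroup G D → C ≢ D → C ∩ D ≡ C₀) →
      ConditionIII G C₀
    enumeration⇒III [] _ complete _ _ =
      ⊥-elim (Anyₚ.¬Any[] (complete (proj₁ (proj₂ (∈-μ-subgroup ε)))))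
    enumeration⇒III Ls@(_ ∷ rest) unique complete sound pairwise =
      List.length rest , Cs , μCs , distinct , petals ,
      Equivalence.from (sum∣Cs∣≡n+k*∣C₀∣⇔⋃ᶠCs≡⊤ Cs petals) ⋃Cs≡⊤
      where
      Cs : Fin (List.length Ls) → SubsetG G
      Cs = List.lookup Ls

      μCs : ∀ i → IsMuSubgroup G (Cs i)
      μCs i = sound (∈ₗ.∈-lookup i)

      distinct : ∀ i j → i ≢ j → Cs i ≢ Cs j
      distinct i j i≢j = i≢j ∘ lookup-injective unique i j

      petals : ∀ i j → i Fin.< j → Cs i ∩ Cs j ≡ C₀
      petals i j i<j = pairwise (Cs i) (Cs j) (μCs i) (μCs j) (distinct i j (Finₚ.<⇒≢ i<j))

      ⋃Cs≡⊤ : ⋃ᶠ Cs ≡ ⊤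
      ⋃Cs≡⊤ = ⊆-antisym (λ _ → ∈⊤) λ {x} _ →
        let C , μC , x∈C = ∈-μ-subgroup x ; C∈Ls = complete μC in
        x∈⋃ᶠ⁺ Cs (Any.index C∈Ls) (subst (x ∈_) (Anyₚ.lookup-index C∈Ls) x∈C)


    flower⇒III : IsFlowerWithPistil G C₀ → ConditionIII G C₀
    flower⇒III (_ , _ , pairwise) =
      enumeration⇒III μ-subgroups μ-subgroups-unique ∈-μ-subgroups⁺ ∈-μ-subgroups⁻ pairwise

proposition3p2 : (G : FinGroup) (C₀ : SubsetG G)
    → ¬ IsCyclicGroup G
    → IsCyclicSubgroup G C₀
    → (IsFlowerWithPistil G C₀ ⇔ ConditionII G C₀)
      × (IsFlowerWithPistil G C₀ ⇔ ConditionIII G C₀)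
proposition3p2 G C₀ ¬cyclic cyclicC₀ =
  mk⇔ (flower⇒II G) (II⇒flower G ¬cyclic cyclicC₀) ,
  mk⇔ (flower⇒III G) (III⇒flower G ¬cyclic (proj₁ cyclicC₀))
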